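{- Let $R$ be a commutative ring with identity. For any $B\in R$ and any positive integer $n$, $$\det[v_{|j-k|}(2B,B)]_{1\le j,k\le n}=\det[v_{|j-k|}(-2B,B)]_{1\le j,k\le n}=2^n(1-B)^{n-1}u_n(1+B,B^2).$$
   Context: For elements $x,y$ of a commutative ring with identity, the Lucas sequences are defined by $u_0(x,y)=0$, $u_1(x,y)=1$, $v_0(x,y)=2$, $v_1(x,y)=x$, and $u_{n+1}(x,y)=xu_n(x,y)-yu_{n-1}(x,y)$, $v_{n+1}(x,y)=xv_n(x,y)-yv_{n-1}(x,y)$ for $n\ge1$. The convention $0^0=1$ is used. -}

module Defs where

open import Level using (Level)
open import Algebra.Bundles using (CommutativeRing)
open import Data.Nat using (ℕ; zero; suc; _∸_)
open import Data.Fin as F using (Fin; toℕ; punchIn)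

module _ {c ℓ : Level} (R : CommutativeRing c ℓ) where
  open CommutativeRing R using (Carrier; _+_; _*_; -_; _-_; 0#; 1#)

  lucasU : Carrier → Carrier → ℕ → Carrier
  lucasU x y zero = 0#
  lucasU x y (suc zero) = 1#
  lucasU x y (suc (suc n)) = x * lucasU x y (suc n) - y * lucasU x y n

  lucasV : Carrier → Carrier → ℕ → Carrier
  lucasV x y zero = 1# + 1#
  lucasV x y (suc zero) = x
  lucasV x y (suc (suc n)) = x * lucasV x y (suc n) - y * lucasV x y n

  pow : Carrier → ℕ → Carrier
  pow a zero = 1#
  pow a (suc n) = a * pow a n

  two : Carrier
  two = 1# + 1#

  sign : ℕ → Carrier
  sign zero = 1#
  sign (suc k) = - sign k

  sumFin : (n : ℕ) → (Fin n → Carrier) → Carrier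
  sumFin zero f = 0#
  sumFin (suc n) f = f F.zero + sumFin n (λ i → f (F.suc i))

  det : (n : ℕ) → (Fin n → Fin n → Carrier) → Carrier
  det zero M = 1#
  det (suc n) M =
    sumFin (suc n) (λ k → sign (toℕ k) * (M F.zero k * det n (λ i j → M (F.suc i) (punchIn k j))))

absDiff : ℕ → ℕ → ℕ
absDiff j k = (j ∸ k) Data.Nat.+ (k ∸ j)

-- Replacing every column C_k, k ≥ 2, of the Toeplitz matrix [v_{|j-k|}(x, y)] by C_k − x C_{k−1} + y C_{k−2}
-- does not change its determinant and, by the recurrence of v, leaves the first row (v₀, v₁, 0, …, 0) and below
-- it a matrix whose first column is a shift of v and whose other columns form a lower Hessenberg Toeplitz matrix
-- (entry s on the superdiagonal, t_{j−k} on and below the diagonal). Expanding along first rows, the determinant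
-- of such a bordered matrix with first column a is a₀ Pₘ + a₁ Qₘ, where (Pₘ, Qₘ) is iterated by a fixed 2×2
-- matrix; by Cayley–Hamilton the Toeplitz determinants therefore satisfy a second-order linear recurrence. For
-- y = B and x² = 4B² its coefficients are 2(1 − B)(1 + B) and 4(1 − B)²B², which is also the recurrence of
-- 2ⁿ(1 − B)ⁿ⁻¹uₙ(1 + B, B²), and two initial values agree.

module Submission where

open import Defs
open import Level using (Level)
open import Algebra.Bundles using (CommutativeRing)
open import Data.Nat using (ℕ; zero; suc; _<_; _≤_; z≤n; s≤s; _≟_; _<?_) renaming (_+_ to _+ℕ_; _*_ to _*ℕ_)
import Data.Nat.Properties as ℕ
open import Data.Fin using (Fin; toℕ; punchIn)
open import Data.Fin.Properties using (toℕ<n)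
open import Data.Integer as ℤ using (ℤ; +_; -[1+_]; _⊖_; _◃_)
import Data.Integer.Properties as ℤ
open import Data.Sign as Sign using (Sign)
open import Data.Product using (_×_; _,_; proj₁)
open import Data.Maybe using (Maybe; just; nothing)
open import Data.Bool using (if_then_else_)
open import Data.Empty using (⊥-elim)
open import Function using (_∘_)
open import Relation.Nullary using (yes; no; does)
open import Relation.Nullary.Decidable using (dec-true; dec-false)
open import Relation.Binary using (tri<; tri≈; tri>)
open import Relation.Binary.PropositionalEquality as ≡ using (_≡_; _≢_)
import Algebra.Solver.Ring.AlmostCommutativeRing as AlmostCommutativeRing
import Algebra.Properties.Ring as RingProperties
import Algebra.Properties.CommutativeSemigroup as CommutativeSemigroupProperties
import Algebra.Properties.Semiring.Mult.TCOptimised as Multiples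

punchInℕ : ℕ → ℕ → ℕ
punchInℕ zero    j       = suc j
punchInℕ (suc k) zero    = zero
punchInℕ (suc k) (suc j) = suc (punchInℕ k j)

-- The position of column c once column k is deleted; irrelevant for c = k.
punchOutℕ : ℕ → ℕ → ℕ
punchOutℕ zero    zero    = zero
punchOutℕ zero    (suc c) = c
punchOutℕ (suc k) zero    = zero
punchOutℕ (suc k) (suc c) = suc (punchOutℕ k c)

toℕ-punchIn : ∀ {n} (k : Fin (suc n)) (j : Fin n) → toℕ (punchIn k j) ≡ punchInℕ (toℕ k) (toℕ j)
toℕ-punchIn Fin.zero    j           = ≡.refl
toℕ-punchIn (Fin.suc k) Fin.zero    = ≡.refl
toℕ-punchIn (Fin.suc k) (Fin.suc j) = ≡.cong suc (toℕ-punchIn k j)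

punchInℕ≢ : ∀ k j → punchInℕ k j ≢ k
punchInℕ≢ (suc k) (suc j) eq = punchInℕ≢ k j (ℕ.suc-injective eq)

punchOutℕ-punchInℕ : ∀ k j → punchOutℕ k (punchInℕ k j) ≡ j
punchOutℕ-punchInℕ zero    j       = ≡.refl
punchOutℕ-punchInℕ (suc k) zero    = ≡.refl
punchOutℕ-punchInℕ (suc k) (suc j) = ≡.cong suc (punchOutℕ-punchInℕ k j)

punchInℕ-punchOutℕ : ∀ {k c} → k ≢ c → punchInℕ k (punchOutℕ k c) ≡ c
punchInℕ-punchOutℕ {zero}  {zero}  k≢c = ⊥-elim (k≢c ≡.refl)
punchInℕ-punchOutℕ {zero}  {suc c} _   = ≡.refl
punchInℕ-punchOutℕ {suc k} {zero}  _   = ≡.refl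
punchInℕ-punchOutℕ {suc k} {suc c} k≢c = ≡.cong suc (punchInℕ-punchOutℕ (k≢c ∘ ≡.cong suc))

punchOutℕ-suc : ∀ {k c} → k ≢ c → k ≢ suc c → punchOutℕ k (suc c) ≡ suc (punchOutℕ k c)
punchOutℕ-suc {zero}        {zero}  k≢c _     = ⊥-elim (k≢c ≡.refl)
punchOutℕ-suc {zero}        {suc c} _   _     = ≡.refl
punchOutℕ-suc {suc zero}    {zero}  _   k≢c+1 = ⊥-elim (k≢c+1 ≡.refl)
punchOutℕ-suc {suc (suc k)} {zero}  _   _     = ≡.refl
punchOutℕ-suc {suc k}       {suc c} k≢c k≢c+1 =
  ≡.cong suc (punchOutℕ-suc (k≢c ∘ ≡.cong suc) (k≢c+1 ∘ ≡.cong suc))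

punchOutℕ< : ∀ {k c n} → k ≢ c → k < suc n → c < suc n → punchOutℕ k c < n
punchOutℕ< {zero}  {zero}               k≢c _         _         = ⊥-elim (k≢c ≡.refl)
punchOutℕ< {zero}  {suc c}              _   _         (s≤s c<n) = c<n
punchOutℕ< {suc k} {zero}  {zero}       _   (s≤s ())  _
punchOutℕ< {suc k} {zero}  {suc n}      _   _         _         = s≤s z≤n
punchOutℕ< {suc k} {suc c} {suc n}      k≢c (s≤s k<n) (s≤s c<n) =
  s≤s (punchOutℕ< (k≢c ∘ ≡.cong suc) k<n c<n)

punchOutℕ-suc< : ∀ {k c n} → k ≢ c → k ≢ suc c → k < suc n → suc c < suc n → suc (punchOutℕ k c) < n
punchOutℕ-suc< k≢c k≢c+1 k<n c+1<n = ≡.subst (_< _) (punchOutℕ-suc k≢c k≢c+1) (punchOutℕ< k≢c+1 k<n c+1<n)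

swapAdjacent : ℕ → ℕ → ℕ
swapAdjacent zero    zero          = 1
swapAdjacent zero    (suc zero)    = 0
swapAdjacent zero    (suc (suc k)) = suc (suc k)
swapAdjacent (suc c) zero          = zero
swapAdjacent (suc c) (suc k)       = suc (swapAdjacent c k)

swapAdjacent-left : ∀ c → swapAdjacent c c ≡ suc c
swapAdjacent-left zero    = ≡.refl
swapAdjacent-left (suc c) = ≡.cong suc (swapAdjacent-left c)

swapAdjacent-right : ∀ c → swapAdjacent c (suc c) ≡ c
swapAdjacent-right zero    = ≡.refl
swapAdjacent-right (suc c) = ≡.cong suc (swapAdjacent-right c)

swapAdjacent-fix : ∀ {c k} → k ≢ c → k ≢ suc c → swapAdjacent c k ≡ k
swapAdjacent-fix {zero}  {zero}        k≢c _     = ⊥-elim (k≢c ≡.refl)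
swapAdjacent-fix {zero}  {suc zero}    _   k≢c+1 = ⊥-elim (k≢c+1 ≡.refl)
swapAdjacent-fix {zero}  {suc (suc k)} _   _     = ≡.refl
swapAdjacent-fix {suc c} {zero}        _   _     = ≡.refl
swapAdjacent-fix {suc c} {suc k}       k≢c k≢c+1 = ≡.cong suc (swapAdjacent-fix (k≢c ∘ ≡.cong suc) (k≢c+1 ∘ ≡.cong suc))

swapAdjacent-punchInℕ-left : ∀ c j → swapAdjacent c (punchInℕ c j) ≡ punchInℕ (suc c) j
swapAdjacent-punchInℕ-left zero    zero    = ≡.refl
swapAdjacent-punchInℕ-left zero    (suc j) = ≡.refl
swapAdjacent-punchInℕ-left (suc c) zero    = ≡.refl
swapAdjacent-punchInℕ-left (suc c) (suc j) = ≡.cong suc (swapAdjacent-punchInℕ-left c j)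

swapAdjacent-punchInℕ-right : ∀ c j → swapAdjacent c (punchInℕ (suc c) j) ≡ punchInℕ c j
swapAdjacent-punchInℕ-right zero    zero    = ≡.refl
swapAdjacent-punchInℕ-right zero    (suc j) = ≡.refl
swapAdjacent-punchInℕ-right (suc c) zero    = ≡.refl
swapAdjacent-punchInℕ-right (suc c) (suc j) = ≡.cong suc (swapAdjacent-punchInℕ-right c j)

swapAdjacent-punchInℕ : ∀ {k c} j → k ≢ c → k ≢ suc c →
  swapAdjacent c (punchInℕ k j) ≡ punchInℕ k (swapAdjacent (punchOutℕ k c) j)
swapAdjacent-punchInℕ {zero}        {zero}  j             k≢c _     = ⊥-elim (k≢c ≡.refl)
swapAdjacent-punchInℕ {zero}        {suc c} j             _   _     = ≡.refl
swapAdjacent-punchInℕ {suc zero}    {zero}  j             _   k≢c+1 = ⊥-elim (k≢c+1 ≡.refl)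
swapAdjacent-punchInℕ {suc (suc k)} {zero}  zero          _   _     = ≡.refl
swapAdjacent-punchInℕ {suc (suc k)} {zero}  (suc zero)    _   _     = ≡.refl
swapAdjacent-punchInℕ {suc (suc k)} {zero}  (suc (suc j)) _   _     = ≡.refl
swapAdjacent-punchInℕ {suc k}       {suc c} zero          _   _     = ≡.refl
swapAdjacent-punchInℕ {suc k}       {suc c} (suc j)       k≢c k≢c+1 =
  ≡.cong suc (swapAdjacent-punchInℕ j (k≢c ∘ ≡.cong suc) (k≢c+1 ∘ ≡.cong suc))

absDiff-zeroˡ : ∀ k → absDiff 0 k ≡ k
absDiff-zeroˡ zero    = ≡.refl
absDiff-zeroˡ (suc k) = ≡.refl

absDiff-zeroʳ : ∀ k → absDiff k 0 ≡ k
absDiff-zeroʳ zero    = ≡.refl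
absDiff-zeroʳ (suc k) = ℕ.+-identityʳ (suc k)

-- With the optimised multiples _×′_,
-- ⟦ + 2 ⟧ℤ reduces to 1# + 1#, so solver constants agree definitionally with `two R` and `lucasV R x y 0`.
module IntegerSolver {c ℓ : Level} (R : CommutativeRing c ℓ) where
  open CommutativeRing R
  open RingProperties ring using (-‿distribˡ-*; -‿distribʳ-*; -‿involutive; -‿+-comm; -0#≈0#)
  open CommutativeSemigroupProperties +-commutativeSemigroup using () renaming (interchange to +-interchange)
  open CommutativeSemigroupProperties *-commutativeSemigroup using () renaming (interchange to *-interchange)
  open Multiples semiring using (1+×; ×-homo-+; ×1-homo-*) renaming (_×_ to _×′_)
  open import Relation.Binary.Reasoning.Setoid setoid

  ⟦_⟧ℤ : ℤ → Carrier
  ⟦ + n ⟧ℤ     = n ×′ 1#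
  ⟦ -[1+ n ] ⟧ℤ = - (suc n ×′ 1#)

  ⟦⟧-neg : ∀ i → ⟦ ℤ.- i ⟧ℤ ≈ - ⟦ i ⟧ℤ
  ⟦⟧-neg (+ zero)  = sym -0#≈0#
  ⟦⟧-neg (+ suc n) = refl
  ⟦⟧-neg -[1+ n ]  = sym (-‿involutive _)

  ⟦⟧-⊖ : ∀ m n → ⟦ m ⊖ n ⟧ℤ ≈ m ×′ 1# - n ×′ 1#
  ⟦⟧-⊖ zero    zero    = sym (trans (+-identityˡ _) -0#≈0#)
  ⟦⟧-⊖ zero    (suc n) = sym (+-identityˡ _)
  ⟦⟧-⊖ (suc m) zero    = sym (trans (+-congˡ -0#≈0#) (+-identityʳ _))
  ⟦⟧-⊖ (suc m) (suc n) = begin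
    ⟦ suc m ⊖ suc n ⟧ℤ                 ≡⟨ ≡.cong ⟦_⟧ℤ (ℤ.[1+m]⊖[1+n]≡m⊖n m n) ⟩
    ⟦ m ⊖ n ⟧ℤ                         ≈⟨ ⟦⟧-⊖ m n ⟩
    a - b                              ≈⟨ +-identityˡ _ ⟨
    0# + (a - b)                       ≈⟨ +-congʳ (-‿inverseʳ 1#) ⟨
    (1# - 1#) + (a - b)                ≈⟨ +-interchange 1# (- 1#) a (- b) ⟩
    (1# + a) + (- 1# - b)              ≈⟨ +-congˡ (-‿+-comm 1# b) ⟩
    (1# + a) - (1# + b)                ≈⟨ +-cong (1+× m 1#) (-‿cong (1+× n 1#)) ⟨
    suc m ×′ 1# - suc n ×′ 1# ∎
    where a = m ×′ 1#; b = n ×′ 1#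

  ⟦⟧-+ : ∀ i j → ⟦ i ℤ.+ j ⟧ℤ ≈ ⟦ i ⟧ℤ + ⟦ j ⟧ℤ
  ⟦⟧-+ (+ m)    (+ n)    = ×-homo-+ 1# m n
  ⟦⟧-+ (+ m)    -[1+ n ] = ⟦⟧-⊖ m (suc n)
  ⟦⟧-+ -[1+ m ] (+ n)    = trans (⟦⟧-⊖ n (suc m)) (+-comm _ _)
  ⟦⟧-+ -[1+ m ] -[1+ n ] = begin
    - (suc (suc (m +ℕ n)) ×′ 1#)     ≡⟨ ≡.cong (λ k → - (suc k ×′ 1#)) (ℕ.+-suc m n) ⟨
    - ((suc m +ℕ suc n) ×′ 1#)       ≈⟨ -‿cong (×-homo-+ 1# (suc m) (suc n)) ⟩
    - (suc m ×′ 1# + suc n ×′ 1#)    ≈⟨ -‿+-comm _ _ ⟨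
    - (suc m ×′ 1#) - suc n ×′ 1# ∎

  sgn : Sign → Carrier
  sgn Sign.+ = 1#
  sgn Sign.- = - 1#

  sgn-* : ∀ s t → sgn (s Sign.* t) ≈ sgn s * sgn t
  sgn-* Sign.+ t      = sym (*-identityˡ _)
  sgn-* Sign.- Sign.+ = sym (*-identityʳ _)
  sgn-* Sign.- Sign.- = begin
    1#              ≈⟨ -‿involutive 1# ⟨
    - - 1#          ≈⟨ -‿cong (*-identityʳ _) ⟨
    - (- 1# * 1#)   ≈⟨ -‿distribʳ-* _ _ ⟩
    - 1# * - 1# ∎

  ⟦⟧-◃ : ∀ s n → ⟦ s ◃ n ⟧ℤ ≈ sgn s * (n ×′ 1#)
  ⟦⟧-◃ Sign.+ n = trans (reflexive (≡.cong ⟦_⟧ℤ (ℤ.+◃n≡+n n))) (sym (*-identityˡ _))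
  ⟦⟧-◃ Sign.- n = begin
    ⟦ Sign.- ◃ n ⟧ℤ   ≡⟨ ≡.cong ⟦_⟧ℤ (ℤ.-◃n≡-n n) ⟩
    ⟦ ℤ.- + n ⟧ℤ      ≈⟨ ⟦⟧-neg (+ n) ⟩
    - (n ×′ 1#)       ≈⟨ -‿cong (*-identityˡ _) ⟨
    - (1# * n ×′ 1#)  ≈⟨ -‿distribˡ-* _ _ ⟩
    - 1# * n ×′ 1# ∎

  ⟦⟧-sign-abs : ∀ i → ⟦ i ⟧ℤ ≈ sgn (ℤ.sign i) * (ℤ.∣ i ∣ ×′ 1#)
  ⟦⟧-sign-abs i = trans (reflexive (≡.cong ⟦_⟧ℤ (≡.sym (ℤ.◃-inverse i)))) (⟦⟧-◃ (ℤ.sign i) ℤ.∣ i ∣)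

  ⟦⟧-* : ∀ i j → ⟦ i ℤ.* j ⟧ℤ ≈ ⟦ i ⟧ℤ * ⟦ j ⟧ℤ
  ⟦⟧-* i j = begin
    ⟦ i ℤ.* j ⟧ℤ
      ≈⟨ ⟦⟧-◃ _ (ℤ.∣ i ∣ *ℕ ℤ.∣ j ∣) ⟩
    sgn (ℤ.sign i Sign.* ℤ.sign j) * (ℤ.∣ i ∣ *ℕ ℤ.∣ j ∣) ×′ 1#
      ≈⟨ *-cong (sgn-* (ℤ.sign i) (ℤ.sign j)) (×1-homo-* ℤ.∣ i ∣ ℤ.∣ j ∣) ⟩
    (sgn (ℤ.sign i) * sgn (ℤ.sign j)) * (ℤ.∣ i ∣ ×′ 1# * ℤ.∣ j ∣ ×′ 1#)
                                                               ≈⟨ *-interchange _ _ _ _ ⟩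
    (sgn (ℤ.sign i) * ℤ.∣ i ∣ ×′ 1#) * (sgn (ℤ.sign j) * ℤ.∣ j ∣ ×′ 1#)
                                                               ≈⟨ *-cong (⟦⟧-sign-abs i) (⟦⟧-sign-abs j) ⟨
    ⟦ i ⟧ℤ * ⟦ j ⟧ℤ ∎

  homomorphism : ℤ.+-*-rawRing AlmostCommutativeRing.-Raw-AlmostCommutative⟶ AlmostCommutativeRing.fromCommutativeRing R
  homomorphism = record
    { ⟦_⟧ = ⟦_⟧ℤ ; +-homo = ⟦⟧-+ ; *-homo = ⟦⟧-* ; -‿homo = ⟦⟧-neg ; 0-homo = refl ; 1-homo = refl }

  ⟦⟧-weaklyDecidable : ∀ i j → Maybe (⟦ i ⟧ℤ ≈ ⟦ j ⟧ℤ)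
  ⟦⟧-weaklyDecidable i j with i ℤ.≟ j
  ... | yes ≡.refl = just refl
  ... | no _       = nothing

  open import Algebra.Solver.Ring ℤ.+-*-rawRing (AlmostCommutativeRing.fromCommutativeRing R) homomorphism ⟦⟧-weaklyDecidable public

module Determinant {c ℓ : Level} (R : CommutativeRing c ℓ) where
  open CommutativeRing R hiding (zero)
  open RingProperties ring using (-‿distribˡ-*; -‿involutive; -‿+-comm; -0#≈0#)
  open CommutativeSemigroupProperties +-commutativeSemigroup using (x∙yz≈y∙xz)
  open IntegerSolver R using (solve; _:=_; _:+_; _:*_; :-_; _:-_; con)
  open import Relation.Binary.Reasoning.Setoid setoid

  Matrix : Set c
  Matrix = ℕ → ℕ → Carrier

  leadingDet : ℕ → Matrix → Carrier
  leadingDet n M = det R n (λ i j → M (toℕ i) (toℕ j))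

  sumℕ : ℕ → (ℕ → Carrier) → Carrier
  sumℕ n f = sumFin R n (λ k → f (toℕ k))

  firstRowMinor : ℕ → Matrix → Matrix
  firstRowMinor k M i j = M (suc i) (punchInℕ k j)

  cofactorTerm : ℕ → Matrix → ℕ → Carrier
  cofactorTerm n M k = sign R k * (M 0 k * leadingDet n (firstRowMinor k M))

  sumFin-cong : ∀ n {f g : Fin n → Carrier} → (∀ k → f k ≈ g k) → sumFin R n f ≈ sumFin R n g
  sumFin-cong zero    f≈g = refl
  sumFin-cong (suc n) f≈g = +-cong (f≈g Fin.zero) (sumFin-cong n (f≈g ∘ Fin.suc))

  sumℕ-cong : ∀ n {f g : ℕ → Carrier} → (∀ k → k < n → f k ≈ g k) → sumℕ n f ≈ sumℕ n g
  sumℕ-cong n f≈g = sumFin-cong n (λ k → f≈g (toℕ k) (toℕ<n k))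

  sumℕ-zero : ∀ n {f : ℕ → Carrier} → (∀ k → k < n → f k ≈ 0#) → sumℕ n f ≈ 0#
  sumℕ-zero zero    f≈0 = refl
  sumℕ-zero (suc n) f≈0 =
    trans (+-cong (f≈0 0 (s≤s z≤n)) (sumℕ-zero n (λ k k<n → f≈0 (suc k) (s≤s k<n)))) (+-identityʳ 0#)

  sumℕ-linear : ∀ n {f g h : ℕ → Carrier} λ′ → (∀ k → k < n → f k ≈ g k + λ′ * h k) →
                sumℕ n f ≈ sumℕ n g + λ′ * sumℕ n h
  sumℕ-linear zero    λ′ _  = sym (trans (+-identityˡ _) (zeroʳ λ′))
  sumℕ-linear (suc n) {f} {g} {h} λ′ f≈ = begin
    f 0 + sumℕ n (f ∘ suc)
      ≈⟨ +-cong (f≈ 0 (s≤s z≤n)) (sumℕ-linear n λ′ (λ k k<n → f≈ (suc k) (s≤s k<n))) ⟩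
    (g 0 + λ′ * h 0) + (G + λ′ * H)
      ≈⟨ solve 5 (λ a b c d l → (a :+ l :* b) :+ (c :+ l :* d) := (a :+ c) :+ l :* (b :+ d))
                 refl (g 0) (h 0) G H λ′ ⟩
    (g 0 + G) + λ′ * (h 0 + H) ∎
    where G = sumℕ n (g ∘ suc); H = sumℕ n (h ∘ suc)

  sumℕ-neg : ∀ n (f : ℕ → Carrier) → sumℕ n (λ k → - f k) ≈ - sumℕ n f
  sumℕ-neg zero    f = sym -0#≈0#
  sumℕ-neg (suc n) f = trans (+-congˡ (sumℕ-neg n (f ∘ suc))) (-‿+-comm _ _)

  sumℕ-swapAdjacent : ∀ n c (f : ℕ → Carrier) → suc c < n → sumℕ n (f ∘ swapAdjacent c) ≈ sumℕ n f
  sumℕ-swapAdjacent (suc (suc n)) zero    f _             = x∙yz≈y∙xz (f 1) (f 0) _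
  sumℕ-swapAdjacent (suc n)       (suc c) f (s≤s c+1<n) = +-congˡ (sumℕ-swapAdjacent n c (f ∘ suc) c+1<n)

  sumℕ-adjacentSupport : ∀ n c {f : ℕ → Carrier} → suc c < n →
                         (∀ k → k < n → k ≢ c → k ≢ suc c → f k ≈ 0#) → sumℕ n f ≈ f c + f (suc c)
  sumℕ-adjacentSupport (suc (suc n)) zero {f} _ f≈0 = begin
    f 0 + (f 1 + sumℕ n (f ∘ suc ∘ suc))
      ≈⟨ +-congˡ (+-congˡ (sumℕ-zero n (λ k k<n → f≈0 (suc (suc k)) (s≤s (s≤s k<n)) (λ ()) (λ ())))) ⟩
    f 0 + (f 1 + 0#)
      ≈⟨ +-congˡ (+-identityʳ _) ⟩
    f 0 + f 1 ∎
  sumℕ-adjacentSupport (suc n) (suc c) {f} (s≤s c+1<n) f≈0 = begin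
    f 0 + sumℕ n (f ∘ suc)
      ≈⟨ +-cong (f≈0 0 (s≤s z≤n) (λ ()) (λ ())) (sumℕ-adjacentSupport n c c+1<n f∘suc≈0) ⟩
    0# + (f (suc c) + f (suc (suc c)))
      ≈⟨ +-identityˡ _ ⟩
    f (suc c) + f (suc (suc c)) ∎
    where
    f∘suc≈0 : ∀ k → k < n → k ≢ c → k ≢ suc c → f (suc k) ≈ 0#
    f∘suc≈0 k k<n k≢c k≢c+1 = f≈0 (suc k) (s≤s k<n) (k≢c ∘ ℕ.suc-injective) (k≢c+1 ∘ ℕ.suc-injective)

  det-cong : ∀ n {M M′ : Fin n → Fin n → Carrier} → (∀ i j → M i j ≈ M′ i j) → det R n M ≈ det R n M′
  det-cong zero    M≈M′ = refl
  det-cong (suc n) M≈M′ = sumFin-cong (suc n) (λ k →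
    *-congˡ {sign R (toℕ k)} (*-cong (M≈M′ Fin.zero k) (det-cong n (λ i j → M≈M′ (Fin.suc i) (punchIn k j)))))

  leadingDet-cong : ∀ n {M M′ : Matrix} → (∀ i j → M i j ≈ M′ i j) → leadingDet n M ≈ leadingDet n M′
  leadingDet-cong n M≈M′ = det-cong n (λ i j → M≈M′ (toℕ i) (toℕ j))

  leadingDet-expand : ∀ n M → leadingDet (suc n) M ≈ sumℕ (suc n) (cofactorTerm n M)
  leadingDet-expand n M = sumFin-cong (suc n) (λ k → *-congˡ {sign R (toℕ k)} (*-congˡ {M 0 (toℕ k)}
    (det-cong n (λ i j → reflexive (≡.cong (M (suc (toℕ i))) (toℕ-punchIn k j))))))

  cofactorTerm-minor≈0 : ∀ n M k → leadingDet n (firstRowMinor k M) ≈ 0# → cofactorTerm n M k ≈ 0#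
  cofactorTerm-minor≈0 n M k minor≈0 = trans (*-congˡ (trans (*-congˡ minor≈0) (zeroʳ _))) (zeroʳ _)

  cofactorTerm-entry≈0 : ∀ n M k → M 0 k ≈ 0# → cofactorTerm n M k ≈ 0#
  cofactorTerm-entry≈0 n M k entry≈0 = trans (*-congˡ (trans (*-congʳ entry≈0) (zeroˡ _))) (zeroʳ _)

  leadingDet-expand₂ : ∀ n M → (∀ k → M 0 (suc (suc k)) ≈ 0#) →
    leadingDet (suc (suc n)) M ≈
      M 0 0 * leadingDet (suc n) (firstRowMinor 0 M) - M 0 1 * leadingDet (suc n) (firstRowMinor 1 M)
  leadingDet-expand₂ n M row≈0 = begin
    leadingDet (suc (suc n)) M
      ≈⟨ leadingDet-expand (suc n) M ⟩
    1# * (a * D) + (- 1# * (b * D′) + rest)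
      ≈⟨ +-congˡ (+-congˡ rest≈0) ⟩
    1# * (a * D) + (- 1# * (b * D′) + 0#)
      ≈⟨ solve 4 (λ a D b D′ → con (+ 1) :* (a :* D) :+ (:- con (+ 1) :* (b :* D′) :+ con (+ 0)) := a :* D :- b :* D′)
                 refl a D b D′ ⟩
    a * D - b * D′ ∎
    where
    a = M 0 0; b = M 0 1
    D = leadingDet (suc n) (firstRowMinor 0 M); D′ = leadingDet (suc n) (firstRowMinor 1 M)
    rest = sumℕ n (λ k → cofactorTerm (suc n) M (suc (suc k)))
    rest≈0 : rest ≈ 0#
    rest≈0 = sumℕ-zero n (λ k _ → cofactorTerm-entry≈0 (suc n) M (suc (suc k)) (row≈0 k))

  leadingDet-linear : ∀ n c {A B C : Matrix} λ′ → c < n →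
    (∀ i k → k ≢ c → A i k ≈ B i k) → (∀ i k → k ≢ c → A i k ≈ C i k) →
    (∀ i → A i c ≈ B i c + λ′ * C i c) →
    leadingDet n A ≈ leadingDet n B + λ′ * leadingDet n C
  leadingDet-linear (suc n) c {A} {B} {C} λ′ c<n A≈B A≈C A≈B+λ′C = begin
    leadingDet (suc n) A
      ≈⟨ leadingDet-expand n A ⟩
    sumℕ (suc n) (cofactorTerm n A)
      ≈⟨ sumℕ-linear (suc n) λ′ termwise ⟩
    sumℕ (suc n) (cofactorTerm n B) + λ′ * sumℕ (suc n) (cofactorTerm n C)
      ≈⟨ +-cong (leadingDet-expand n B) (*-congˡ (leadingDet-expand n C)) ⟨
    leadingDet (suc n) B + λ′ * leadingDet (suc n) C ∎
    where
    termwise : ∀ k → k < suc n → cofactorTerm n A k ≈ cofactorTerm n B k + λ′ * cofactorTerm n C k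
    termwise k k<n with k ≟ c
    ... | yes ≡.refl = begin
      s * (A 0 k * dA)
        ≈⟨ *-congˡ (*-cong (A≈B+λ′C 0) dA≈dB) ⟩
      s * ((B 0 k + λ′ * C 0 k) * dB)
        ≈⟨ solve 5 (λ s b l c d → s :* ((b :+ l :* c) :* d) := s :* (b :* d) :+ l :* (s :* (c :* d)))
                   refl s (B 0 k) λ′ (C 0 k) dB ⟩
      s * (B 0 k * dB) + λ′ * (s * (C 0 k * dB))
        ≈⟨ +-congˡ (*-congˡ (*-congˡ (*-congˡ (trans (sym dA≈dB) dA≈dC)))) ⟩
      s * (B 0 k * dB) + λ′ * (s * (C 0 k * dC)) ∎
      where
      s = sign R k
      dA = leadingDet n (firstRowMinor k A); dB = leadingDet n (firstRowMinor k B)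
      dC = leadingDet n (firstRowMinor k C)
      dA≈dB : dA ≈ dB
      dA≈dB = leadingDet-cong n (λ i j → A≈B (suc i) (punchInℕ k j) (punchInℕ≢ k j))
      dA≈dC : dA ≈ dC
      dA≈dC = leadingDet-cong n (λ i j → A≈C (suc i) (punchInℕ k j) (punchInℕ≢ k j))
    ... | no k≢c = begin
      s * (A 0 k * dA)
        ≈⟨ *-congˡ (*-congˡ minorLinear) ⟩
      s * (A 0 k * (dB + λ′ * dC))
        ≈⟨ solve 5 (λ s a l b c → s :* (a :* (b :+ l :* c)) := s :* (a :* b) :+ l :* (s :* (a :* c)))
                   refl s (A 0 k) λ′ dB dC ⟩
      s * (A 0 k * dB) + λ′ * (s * (A 0 k * dC))
        ≈⟨ +-cong (*-congˡ (*-congʳ (A≈B 0 k k≢c))) (*-congˡ (*-congˡ (*-congʳ (A≈C 0 k k≢c)))) ⟩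
      s * (B 0 k * dB) + λ′ * (s * (C 0 k * dC)) ∎
      where
      s = sign R k
      dA = leadingDet n (firstRowMinor k A); dB = leadingDet n (firstRowMinor k B)
      dC = leadingDet n (firstRowMinor k C)
      c′ = punchOutℕ k c
      avoids-c : ∀ j → j ≢ c′ → punchInℕ k j ≢ c
      avoids-c j j≢c′ eq = j≢c′ (≡.trans (≡.sym (punchOutℕ-punchInℕ k j)) (≡.cong (punchOutℕ k) eq))
      minorLinear : dA ≈ dB + λ′ * dC
      minorLinear = leadingDet-linear n c′ λ′ (punchOutℕ< k≢c k<n c<n)
        (λ i j j≢c′ → A≈B (suc i) (punchInℕ k j) (avoids-c j j≢c′))
        (λ i j j≢c′ → A≈C (suc i) (punchInℕ k j) (avoids-c j j≢c′))
        (λ i → ≡.subst (λ z → A (suc i) z ≈ B (suc i) z + λ′ * C (suc i) z)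
                       (≡.sym (punchInℕ-punchOutℕ k≢c)) (A≈B+λ′C (suc i)))

  swapAdjacent-invariant : ∀ (v : ℕ → Carrier) c → v c ≈ v (suc c) → ∀ k → v (swapAdjacent c k) ≈ v k
  swapAdjacent-invariant v zero    v0≈v1 zero          = sym v0≈v1
  swapAdjacent-invariant v zero    v0≈v1 (suc zero)    = v0≈v1
  swapAdjacent-invariant v zero    v0≈v1 (suc (suc k)) = refl
  swapAdjacent-invariant v (suc c) vc≈vc+1 zero        = refl
  swapAdjacent-invariant v (suc c) vc≈vc+1 (suc k)     = swapAdjacent-invariant (v ∘ suc) c vc≈vc+1 k

  leadingDet-adjacentEqualColumns : ∀ n c {M : Matrix} → suc c < n → (∀ i → M i c ≈ M i (suc c)) →
                                    leadingDet n M ≈ 0#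
  leadingDet-adjacentEqualColumns (suc n) c {M} c+1<n Mc≈Mc+1 = begin
    leadingDet (suc n) M
      ≈⟨ leadingDet-expand n M ⟩
    sumℕ (suc n) (cofactorTerm n M)
      ≈⟨ sumℕ-adjacentSupport (suc n) c c+1<n vanishing ⟩
    s * (M 0 c * D) + - s * (M 0 (suc c) * D′)
      ≈⟨ +-congˡ (*-congˡ (*-cong (sym (Mc≈Mc+1 0)) (sym D≈D′))) ⟩
    s * (M 0 c * D) + - s * (M 0 c * D)
      ≈⟨ solve 3 (λ s a d → s :* (a :* d) :+ :- s :* (a :* d) := con (+ 0)) refl s (M 0 c) D ⟩
    0# ∎
    where
    s = sign R c
    D = leadingDet n (firstRowMinor c M); D′ = leadingDet n (firstRowMinor (suc c) M)
    D≈D′ : D ≈ D′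
    D≈D′ = leadingDet-cong n (λ i j → trans (sym (swapAdjacent-invariant (M (suc i)) c (Mc≈Mc+1 (suc i)) (punchInℕ c j)))
                                             (reflexive (≡.cong (M (suc i)) (swapAdjacent-punchInℕ-left c j))))
    vanishing : ∀ k → k < suc n → k ≢ c → k ≢ suc c → cofactorTerm n M k ≈ 0#
    vanishing k k<n k≢c k≢c+1 = cofactorTerm-minor≈0 n M k
      (leadingDet-adjacentEqualColumns n (punchOutℕ k c) {firstRowMinor k M} (punchOutℕ-suc< k≢c k≢c+1 k<n c+1<n) columns)
      where
      columns : ∀ i → M (suc i) (punchInℕ k (punchOutℕ k c)) ≈ M (suc i) (punchInℕ k (suc (punchOutℕ k c)))
      columns i = begin
        M (suc i) (punchInℕ k (punchOutℕ k c))
          ≡⟨ ≡.cong (M (suc i)) (punchInℕ-punchOutℕ k≢c) ⟩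
        M (suc i) c
          ≈⟨ Mc≈Mc+1 (suc i) ⟩
        M (suc i) (suc c)
          ≡⟨ ≡.cong (M (suc i)) (punchInℕ-punchOutℕ k≢c+1) ⟨
        M (suc i) (punchInℕ k (punchOutℕ k (suc c)))
          ≡⟨ ≡.cong (M (suc i) ∘ punchInℕ k) (punchOutℕ-suc k≢c k≢c+1) ⟩
        M (suc i) (punchInℕ k (suc (punchOutℕ k c))) ∎

  leadingDet-swapAdjacentColumns : ∀ n c (M : Matrix) → suc c < n →
                                   leadingDet n (λ i k → M i (swapAdjacent c k)) ≈ - leadingDet n M
  leadingDet-swapAdjacentColumns (suc n) c M c+1<n = begin
    leadingDet (suc n) M′
      ≈⟨ leadingDet-expand n M′ ⟩
    sumℕ (suc n) (cofactorTerm n M′)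
      ≈⟨ sumℕ-cong (suc n) termwise ⟩
    sumℕ (suc n) (λ k → - cofactorTerm n M (swapAdjacent c k))
      ≈⟨ sumℕ-neg (suc n) (cofactorTerm n M ∘ swapAdjacent c) ⟩
    - sumℕ (suc n) (cofactorTerm n M ∘ swapAdjacent c)
      ≈⟨ -‿cong (sumℕ-swapAdjacent (suc n) c (cofactorTerm n M) c+1<n) ⟩
    - sumℕ (suc n) (cofactorTerm n M)
      ≈⟨ -‿cong (leadingDet-expand n M) ⟨
    - leadingDet (suc n) M ∎
    where
    M′ : Matrix
    M′ i k = M i (swapAdjacent c k)
    minor : ∀ k → Carrier
    minor k = leadingDet n (firstRowMinor k M)
    minor′ : ∀ k {g : ℕ → ℕ} → (∀ j → swapAdjacent c (punchInℕ k j) ≡ g j) →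
             leadingDet n (firstRowMinor k M′) ≈ leadingDet n (λ i j → M (suc i) (g j))
    minor′ k swap∘punchIn≡g = leadingDet-cong n (λ i j → reflexive (≡.cong (M (suc i)) (swap∘punchIn≡g j)))
    termwise : ∀ k → k < suc n → cofactorTerm n M′ k ≈ - cofactorTerm n M (swapAdjacent c k)
    termwise k k<n with k ≟ c | k ≟ suc c
    ... | yes ≡.refl | _ rewrite swapAdjacent-left k = begin
      sign R k * (M 0 (suc k) * leadingDet n (firstRowMinor k M′))
        ≈⟨ *-congˡ (*-congˡ (minor′ k (swapAdjacent-punchInℕ-left k))) ⟩
      sign R k * (M 0 (suc k) * minor (suc k))
        ≈⟨ solve 2 (λ s X → s :* X := :- (:- s :* X)) refl (sign R k) _ ⟩
      - (- sign R k * (M 0 (suc k) * minor (suc k))) ∎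
    ... | no _ | yes ≡.refl rewrite swapAdjacent-right c = begin
      - sign R c * (M 0 c * leadingDet n (firstRowMinor (suc c) M′))
        ≈⟨ *-congˡ (*-congˡ (minor′ (suc c) (swapAdjacent-punchInℕ-right c))) ⟩
      - sign R c * (M 0 c * minor c)
        ≈⟨ -‿distribˡ-* _ _ ⟨
      - (sign R c * (M 0 c * minor c)) ∎
    ... | no k≢c | no k≢c+1 rewrite swapAdjacent-fix k≢c k≢c+1 = begin
      sign R k * (M 0 k * leadingDet n (firstRowMinor k M′))
        ≈⟨ *-congˡ (*-congˡ (minor′ k (λ j → swapAdjacent-punchInℕ j k≢c k≢c+1))) ⟩
      sign R k * (M 0 k * leadingDet n (λ i j → firstRowMinor k M i (swapAdjacent (punchOutℕ k c) j)))
        ≈⟨ *-congˡ (*-congˡ (leadingDet-swapAdjacentColumns n (punchOutℕ k c) (firstRowMinor k M)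
                                (punchOutℕ-suc< k≢c k≢c+1 k<n c+1<n))) ⟩
      sign R k * (M 0 k * - minor k)
        ≈⟨ solve 3 (λ s a d → s :* (a :* :- d) := :- (s :* (a :* d))) refl (sign R k) (M 0 k) (minor k) ⟩
      - (sign R k * (M 0 k * minor k)) ∎

  leadingDet-distanceTwoEqualColumns : ∀ n c {M : Matrix} → suc (suc c) < n → (∀ i → M i c ≈ M i (suc (suc c))) →
                                       leadingDet n M ≈ 0#
  leadingDet-distanceTwoEqualColumns n c {M} c+2<n Mc≈Mc+2 = begin
    leadingDet n M
      ≈⟨ -‿involutive _ ⟨
    - - leadingDet n M
      ≈⟨ -‿cong (leadingDet-swapAdjacentColumns n (suc c) M c+2<n) ⟨
    - leadingDet n M′
      ≈⟨ -‿cong (leadingDet-adjacentEqualColumns n c {M′} (ℕ.<-trans (ℕ.n<1+n (suc c)) c+2<n) columns) ⟩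
    - 0#
      ≈⟨ -0#≈0# ⟩
    0# ∎
    where
    M′ : Matrix
    M′ i k = M i (swapAdjacent (suc c) k)
    columns : ∀ i → M′ i c ≈ M′ i (suc c)
    columns i = begin
      M i (swapAdjacent (suc c) c)
        ≡⟨ ≡.cong (M i) (swapAdjacent-fix (ℕ.<⇒≢ (ℕ.n<1+n c)) (ℕ.<⇒≢ (ℕ.m<n⇒m<1+n (ℕ.n<1+n c)))) ⟩
      M i c
        ≈⟨ Mc≈Mc+2 i ⟩
      M i (suc (suc c))
        ≡⟨ ≡.cong (M i) (swapAdjacent-left (suc c)) ⟨
      M i (swapAdjacent (suc c) (suc c)) ∎

  replaceColumn : ℕ → (ℕ → Carrier) → Matrix → Matrix
  replaceColumn c v M i k with k ≟ c
  ... | yes _ = v i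
  ... | no  _ = M i k

  replaceColumn-at : ∀ c v M i → replaceColumn c v M i c ≈ v i
  replaceColumn-at c v M i with c ≟ c
  ... | yes _   = refl
  ... | no  c≢c = ⊥-elim (c≢c ≡.refl)

  replaceColumn-off : ∀ {c k} v M i → k ≢ c → replaceColumn c v M i k ≈ M i k
  replaceColumn-off {c} {k} v M i k≢c with k ≟ c
  ... | yes k≡c = ⊥-elim (k≢c k≡c)
  ... | no  _   = refl

  leadingDet-addPrecedingColumns : ∀ n q {A B : Matrix} p w → suc (suc q) < n →
    (∀ i k → k ≢ suc (suc q) → A i k ≈ B i k) →
    (∀ i → A i (suc (suc q)) ≈ B i (suc (suc q)) - p * B i (suc q) + w * B i q) →
    leadingDet n A ≈ leadingDet n B
  leadingDet-addPrecedingColumns n q {A} {B} p w r<n A≈B Ar≈ = begin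
    leadingDet n A
      ≈⟨ leadingDet-linear n r w r<n A≈Mid A≈Bq Ar≈Mid+wBq ⟩
    leadingDet n Mid + w * leadingDet n Bq
      ≈⟨ +-cong Mid≈B-pBq+1 (*-congˡ Bq≈0) ⟩
    (leadingDet n B + - p * leadingDet n Bq+1) + w * 0#
      ≈⟨ +-congʳ (+-congˡ (*-congˡ Bq+1≈0)) ⟩
    (leadingDet n B + - p * 0#) + w * 0#
      ≈⟨ solve 3 (λ d p w → (d :+ :- p :* con (+ 0)) :+ w :* con (+ 0) := d) refl (leadingDet n B) p w ⟩
    leadingDet n B ∎
    where
    r = suc (suc q)
    midColumn : ℕ → Carrier
    midColumn i = B i r + - p * B i (suc q)
    columnOfB : ℕ → ℕ → Carrier
    columnOfB k i = B i k
    Mid Bq Bq+1 : Matrix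
    Mid  = replaceColumn r midColumn B
    Bq   = replaceColumn r (columnOfB q) B
    Bq+1 = replaceColumn r (columnOfB (suc q)) B
    q≢r : q ≢ r
    q≢r = ℕ.<⇒≢ (ℕ.m<n⇒m<1+n (ℕ.n<1+n q))
    q+1≢r : suc q ≢ r
    q+1≢r = ℕ.<⇒≢ (ℕ.n<1+n (suc q))
    A≈Mid : ∀ i k → k ≢ r → A i k ≈ Mid i k
    A≈Mid i k k≢r = trans (A≈B i k k≢r) (sym (replaceColumn-off midColumn B i k≢r))
    A≈Bq : ∀ i k → k ≢ r → A i k ≈ Bq i k
    A≈Bq i k k≢r = trans (A≈B i k k≢r) (sym (replaceColumn-off (columnOfB q) B i k≢r))
    Ar≈Mid+wBq : ∀ i → A i r ≈ Mid i r + w * Bq i r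
    Ar≈Mid+wBq i = trans (Ar≈ i) (sym (+-cong (trans (replaceColumn-at r midColumn B i) (+-congˡ (sym (-‿distribˡ-* p _))))
                                              (*-congˡ (replaceColumn-at r (columnOfB q) B i))))
    Mid≈B-pBq+1 : leadingDet n Mid ≈ leadingDet n B + - p * leadingDet n Bq+1
    Mid≈B-pBq+1 = leadingDet-linear n r (- p) r<n
      (λ i k k≢r → replaceColumn-off midColumn B i k≢r)
      (λ i k k≢r → trans (replaceColumn-off midColumn B i k≢r) (sym (replaceColumn-off (columnOfB (suc q)) B i k≢r)))
      (λ i → trans (replaceColumn-at r midColumn B i) (+-congˡ (*-congˡ (sym (replaceColumn-at r (columnOfB (suc q)) B i)))))
    Bq≈0 : leadingDet n Bq ≈ 0#
    Bq≈0 = leadingDet-distanceTwoEqualColumns n q {Bq} r<n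
      (λ i → trans (replaceColumn-off (columnOfB q) B i q≢r) (sym (replaceColumn-at r (columnOfB q) B i)))
    Bq+1≈0 : leadingDet n Bq+1 ≈ 0#
    Bq+1≈0 = leadingDet-adjacentEqualColumns n (suc q) {Bq+1} r<n
      (λ i → trans (replaceColumn-off (columnOfB (suc q)) B i q+1≢r) (sym (replaceColumn-at r (columnOfB (suc q)) B i)))

  columnReduce : Carrier → Carrier → Matrix → Matrix
  columnReduce p w M i zero          = M i zero
  columnReduce p w M i (suc zero)    = M i (suc zero)
  columnReduce p w M i (suc (suc k)) = M i (suc (suc k)) - p * M i (suc k) + w * M i k

  module _ (p w : Carrier) (M : Matrix) where
    private
      -- Reducing the columns one at a time from the left, each step only uses columns that are not yet reduced.
      reducedFrom : ℕ → Matrix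
      reducedFrom r i k = if does (k <? r) then M i k else columnReduce p w M i k

      reducedFrom-< : ∀ {r i k} → k < r → reducedFrom r i k ≡ M i k
      reducedFrom-< {r} {i} {k} k<r rewrite dec-true (k <? r) k<r = ≡.refl

      reducedFrom-≥ : ∀ {r i k} → r ≤ k → reducedFrom r i k ≡ columnReduce p w M i k
      reducedFrom-≥ {r} {i} {k} r≤k rewrite dec-false (k <? r) (ℕ.≤⇒≯ r≤k) = ≡.refl

      reducedFrom-beyond : ∀ n r → n ≤ r → leadingDet n (reducedFrom r) ≈ leadingDet n M
      reducedFrom-beyond n r n≤r = det-cong n (λ i j → reflexive (reducedFrom-< (ℕ.<-≤-trans (toℕ<n j) n≤r)))

      reducedFrom-step : ∀ n q → suc (suc q) < n →
                         leadingDet n (reducedFrom (suc (suc q))) ≈ leadingDet n (reducedFrom (suc (suc (suc q))))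
      reducedFrom-step n q r<n = leadingDet-addPrecedingColumns n q {reducedFrom (suc (suc q))} p w r<n agree column
        where
        r = suc (suc q)
        agree : ∀ i k → k ≢ r → reducedFrom r i k ≈ reducedFrom (suc r) i k
        agree i k k≢r with ℕ.<-cmp k r
        ... | tri< k<r _ _ = reflexive (≡.trans (reducedFrom-< k<r) (≡.sym (reducedFrom-< (ℕ.m<n⇒m<1+n k<r))))
        ... | tri≈ _ k≡r _ = ⊥-elim (k≢r k≡r)
        ... | tri> _ _ r<k = reflexive (≡.trans (reducedFrom-≥ (ℕ.<⇒≤ r<k)) (≡.sym (reducedFrom-≥ r<k)))
        column : ∀ i → reducedFrom r i r ≈
                       reducedFrom (suc r) i r - p * reducedFrom (suc r) i (suc q) + w * reducedFrom (suc r) i q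
        column i = begin
          reducedFrom r i r
            ≡⟨ reducedFrom-≥ {r} {i} {r} ℕ.≤-refl ⟩
          M i r - p * M i (suc q) + w * M i q
            ≈⟨ +-cong (+-cong (unchanged r<r+1) (-‿cong (*-congˡ (unchanged q+1<r+1)))) (*-congˡ (unchanged q<r+1)) ⟨
          reducedFrom (suc r) i r - p * reducedFrom (suc r) i (suc q) + w * reducedFrom (suc r) i q ∎
          where
          unchanged : ∀ {k} → k < suc r → reducedFrom (suc r) i k ≈ M i k
          unchanged k<r+1 = reflexive (reducedFrom-< k<r+1)
          r<r+1 : r < suc r
          r<r+1 = ℕ.n<1+n r
          q+1<r+1 : suc q < suc r
          q+1<r+1 = ℕ.m<n⇒m<1+n (ℕ.n<1+n (suc q))
          q<r+1 : q < suc r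
          q<r+1 = ℕ.<-trans (ℕ.n<1+n q) q+1<r+1

      reducedFrom-chain : ∀ n e q → n ≤ suc (suc q) +ℕ e → leadingDet n (reducedFrom (suc (suc q))) ≈ leadingDet n M
      reducedFrom-chain n zero    q n≤r = reducedFrom-beyond n _ (≡.subst (n ≤_) (ℕ.+-identityʳ _) n≤r)
      reducedFrom-chain n (suc e) q n≤r+e+1 with suc (suc q) <? n
      ... | yes r<n = trans (reducedFrom-step n q r<n)
                            (reducedFrom-chain n e (suc q) (≡.subst (n ≤_) (ℕ.+-suc (suc (suc q)) e) n≤r+e+1))
      ... | no  r≮n = reducedFrom-beyond n _ (ℕ.≮⇒≥ r≮n)

    leadingDet-columnReduce : ∀ n → leadingDet n (columnReduce p w M) ≈ leadingDet n M
    leadingDet-columnReduce n = trans (leadingDet-cong n reduced≈reducedFrom2) (reducedFrom-chain n n 0 (ℕ.m≤n+m n 2))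
      where
      reduced≈reducedFrom2 : ∀ i k → columnReduce p w M i k ≈ reducedFrom 2 i k
      reduced≈reducedFrom2 i 0             = refl
      reduced≈reducedFrom2 i 1             = refl
      reduced≈reducedFrom2 i (suc (suc k)) = refl

module Recurrence {c ℓ : Level} (R : CommutativeRing c ℓ) where
  open CommutativeRing R hiding (zero)
  open IntegerSolver R using (solve; _:=_; _:+_; _:*_; _:-_; con)
  open import Relation.Binary.Reasoning.Setoid setoid

  LinearRecurrence : Carrier → Carrier → (ℕ → Carrier) → Set ℓ
  LinearRecurrence p q a = ∀ i → a (suc (suc i)) ≈ p * a (suc i) - q * a i

  linearRecurrence-cong : ∀ {p p′ q q′ a} → p ≈ p′ → q ≈ q′ → LinearRecurrence p q a → LinearRecurrence p′ q′ a
  linearRecurrence-cong p≈p′ q≈q′ rec i = trans (rec i) (+-cong (*-congʳ p≈p′) (-‿cong (*-congʳ q≈q′)))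

  linearRecurrence-unique : ∀ {p q a b} → LinearRecurrence p q a → LinearRecurrence p q b →
                            a 0 ≈ b 0 → a 1 ≈ b 1 → ∀ i → a i ≈ b i
  linearRecurrence-unique {a = a} {b} recA recB a0≈b0 a1≈b1 i = proj₁ (agreeFrom i)
    where
    agreeFrom : ∀ i → a i ≈ b i × a (suc i) ≈ b (suc i)
    agreeFrom zero    = a0≈b0 , a1≈b1
    agreeFrom (suc i) with agreeFrom i
    ... | ai≈bi , ai+1≈bi+1 =
      ai+1≈bi+1 , trans (recA i) (trans (+-cong (*-congˡ ai+1≈bi+1) (-‿cong (*-congˡ ai≈bi))) (sym (recB i)))

  linearRecurrence-residual : ∀ {p q a} → LinearRecurrence p q a → ∀ i → a (suc (suc i)) - p * a (suc i) + q * a i ≈ 0#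
  linearRecurrence-residual {p} {q} {a} rec i = begin
    a (suc (suc i)) - p * a (suc i) + q * a i
      ≈⟨ +-congʳ (+-congʳ (rec i)) ⟩
    (p * a (suc i) - q * a i) - p * a (suc i) + q * a i
      ≈⟨ solve 4 (λ p q u v → (p :* v :- q :* u) :- p :* v :+ q :* u := con (+ 0)) refl p q (a i) (a (suc i)) ⟩
    0# ∎

  cayleyHamilton : ∀ {m₁₁ m₁₂ m₂₁ m₂₂} α β {P Q : ℕ → Carrier} →
    (∀ k → P (suc k) ≈ m₁₁ * P k + m₁₂ * Q k) → (∀ k → Q (suc k) ≈ m₂₁ * P k + m₂₂ * Q k) →
    LinearRecurrence (m₁₁ + m₂₂) (m₁₁ * m₂₂ - m₁₂ * m₂₁) (λ k → α * P k + β * Q k)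
  cayleyHamilton {m₁₁} {m₁₂} {m₂₁} {m₂₂} α β {P} {Q} P≈ Q≈ k = begin
    α * P (suc (suc k)) + β * Q (suc (suc k))
      ≈⟨ +-cong (*-congˡ (trans (P≈ (suc k)) step)) (*-congˡ (trans (Q≈ (suc k)) step)) ⟩
    α * (m₁₁ * P′ + m₁₂ * Q′) + β * (m₂₁ * P′ + m₂₂ * Q′)
      ≈⟨ solve 8 (λ a b c d α β p q →
           let p′ = a :* p :+ b :* q ; q′ = c :* p :+ d :* q in
           α :* (a :* p′ :+ b :* q′) :+ β :* (c :* p′ :+ d :* q′)
             := (a :+ d) :* (α :* p′ :+ β :* q′) :- (a :* d :- b :* c) :* (α :* p :+ β :* q))
         refl m₁₁ m₁₂ m₂₁ m₂₂ α β (P k) (Q k) ⟩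
    (m₁₁ + m₂₂) * (α * P′ + β * Q′) - (m₁₁ * m₂₂ - m₁₂ * m₂₁) * (α * P k + β * Q k)
      ≈⟨ +-congʳ (*-congˡ step) ⟨
    (m₁₁ + m₂₂) * (α * P (suc k) + β * Q (suc k)) - (m₁₁ * m₂₂ - m₁₂ * m₂₁) * (α * P k + β * Q k) ∎
    where
    P′ = m₁₁ * P k + m₁₂ * Q k
    Q′ = m₂₁ * P k + m₂₂ * Q k
    step : ∀ {a b} → a * P (suc k) + b * Q (suc k) ≈ a * P′ + b * Q′
    step = +-cong (*-congˡ (P≈ k)) (*-congˡ (Q≈ k))

module LucasToeplitz {c ℓ : Level} (R : CommutativeRing c ℓ) (x y : CommutativeRing.Carrier R) where
  open CommutativeRing R hiding (zero)
  open Determinant R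
  open Recurrence R
  open IntegerSolver R using (solve; _:=_; _:+_; _:*_; :-_; _:-_; con)
  open import Relation.Binary.Reasoning.Setoid setoid

  V : ℕ → Carrier
  V = lucasV R x y

  V-recurrence : LinearRecurrence x y V
  V-recurrence i = refl

  toeplitz : Matrix
  toeplitz j k = V (absDiff j k)

  s : Carrier
  s = V 1 - x * V 0 + y * V 1

  t : ℕ → Carrier
  t i = V i - x * V (suc i) + y * V (suc (suc i))

  t-recurrence : LinearRecurrence x y t
  t-recurrence i = solve 4 (λ x y u v →
      let w₂ = x :* v :- y :* u ; w₃ = x :* w₂ :- y :* v ; w₄ = x :* w₃ :- y :* w₂ in
      w₂ :- x :* w₃ :+ y :* w₄ := x :* (v :- x :* w₂ :+ y :* w₃) :- y :* (u :- x :* v :+ y :* w₂))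
    refl x y (V i) (V (suc i))

  -- Entry (j, k) is entry (j + 1, k + 2) of columnReduce x y toeplitz.
  hessenberg : ℕ → ℕ → Carrier
  hessenberg zero    zero    = s
  hessenberg zero    (suc k) = 0#
  hessenberg (suc j) zero    = t j
  hessenberg (suc j) (suc k) = hessenberg j k

  bordered : (ℕ → Carrier) → Matrix
  bordered a j zero    = a j
  bordered a j (suc k) = hessenberg j k

  -- Expanding bordered a along its first row gives a₀ det (bordered t) − s det (bordered (a ∘ suc)),
  -- and a₂ = x a₁ − y a₀; this is the linear recursion below.
  P Q : ℕ → Carrier
  P zero    = 1#
  P (suc m) = t 0 * P m + (t 1 + s * y) * Q m
  Q zero    = 0#
  Q (suc m) = - s * P m + - (s * x) * Q m

  leadingDet-bordered : ∀ m a → LinearRecurrence x y a → leadingDet (suc m) (bordered a) ≈ a 0 * P m + a 1 * Q m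
  leadingDet-bordered zero    a _   =
    solve 2 (λ a₀ a₁ → con (+ 1) :* (a₀ :* con (+ 1)) :+ con (+ 0) := a₀ :* con (+ 1) :+ a₁ :* con (+ 0)) refl (a 0) (a 1)
  leadingDet-bordered (suc m) a rec = begin
    leadingDet (suc (suc m)) (bordered a)
      ≈⟨ leadingDet-expand₂ m (bordered a) (λ _ → refl) ⟩
    a 0 * leadingDet (suc m) (firstRowMinor 0 (bordered a)) - s * leadingDet (suc m) (firstRowMinor 1 (bordered a))
      ≈⟨ +-cong (*-congˡ det-minor₀) (-‿cong (*-congˡ det-minor₁)) ⟩
    a 0 * (t 0 * P m + t 1 * Q m) - s * (a 1 * P m + (x * a 1 - y * a 0) * Q m)
      ≈⟨ solve 9 (λ a₀ a₁ t₀ t₁ s x y p q →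
           a₀ :* (t₀ :* p :+ t₁ :* q) :- s :* (a₁ :* p :+ (x :* a₁ :- y :* a₀) :* q)
             := a₀ :* (t₀ :* p :+ (t₁ :+ s :* y) :* q) :+ a₁ :* (:- s :* p :+ :- (s :* x) :* q))
         refl (a 0) (a 1) (t 0) (t 1) s x y (P m) (Q m) ⟩
    a 0 * P (suc m) + a 1 * Q (suc m) ∎
    where
    minor₀ : ∀ i j → firstRowMinor 0 (bordered a) i j ≈ bordered t i j
    minor₀ i zero    = refl
    minor₀ i (suc k) = refl
    minor₁ : ∀ i j → firstRowMinor 1 (bordered a) i j ≈ bordered (a ∘ suc) i j
    minor₁ i zero    = refl
    minor₁ i (suc k) = refl
    det-minor₀ : leadingDet (suc m) (firstRowMinor 0 (bordered a)) ≈ t 0 * P m + t 1 * Q m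
    det-minor₀ = trans (leadingDet-cong (suc m) minor₀) (leadingDet-bordered m t t-recurrence)
    det-minor₁ : leadingDet (suc m) (firstRowMinor 1 (bordered a)) ≈ a 1 * P m + (x * a 1 - y * a 0) * Q m
    det-minor₁ = trans (leadingDet-cong (suc m) minor₁)
                       (trans (leadingDet-bordered m (a ∘ suc) (rec ∘ suc)) (+-congˡ (*-congʳ (rec 0))))

  reduced : Matrix
  reduced = columnReduce x y toeplitz

  reduced-firstRow : ∀ k → reduced 0 (suc (suc k)) ≈ 0#
  reduced-firstRow k = begin
    V (absDiff 0 (suc (suc k))) - x * V (absDiff 0 (suc k)) + y * V (absDiff 0 k)
      ≡⟨ ≡.cong (λ j → V (suc (suc k)) - x * V (suc k) + y * V j) (absDiff-zeroˡ k) ⟩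
    V (suc (suc k)) - x * V (suc k) + y * V k
      ≈⟨ linearRecurrence-residual V-recurrence k ⟩
    0# ∎

  reduced-hessenberg : ∀ i k → reduced (suc i) (suc (suc k)) ≈ hessenberg i k
  reduced-hessenberg zero    zero    = refl
  reduced-hessenberg zero    (suc k) = reduced-firstRow k
  reduced-hessenberg (suc i) zero    = begin
    V (absDiff i 0) - x * V (absDiff (suc i) 0) + y * V (absDiff (suc (suc i)) 0)
      ≡⟨ ≡.cong₂ (λ j l → V j - x * V l + y * V (absDiff (suc (suc i)) 0)) (absDiff-zeroʳ i) (absDiff-zeroʳ (suc i)) ⟩
    V i - x * V (suc i) + y * V (absDiff (suc (suc i)) 0)
      ≡⟨ ≡.cong (λ j → V i - x * V (suc i) + y * V j) (absDiff-zeroʳ (suc (suc i))) ⟩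
    t i ∎
  reduced-hessenberg (suc i) (suc k) = reduced-hessenberg i k

  α β : Carrier
  α = V 0 * V 0 - x * V 1
  β = V 0 * V 1 - x * V 2

  toeplitzForm : ℕ → Carrier
  toeplitzForm m = α * P m + β * Q m

  leadingDet-toeplitz : ∀ m → leadingDet (suc (suc m)) toeplitz ≈ toeplitzForm m
  leadingDet-toeplitz m = begin
    leadingDet (suc (suc m)) toeplitz
      ≈⟨ leadingDet-columnReduce x y toeplitz (suc (suc m)) ⟨
    leadingDet (suc (suc m)) reduced
      ≈⟨ leadingDet-expand₂ m reduced reduced-firstRow ⟩
    V 0 * leadingDet (suc m) (firstRowMinor 0 reduced) - x * leadingDet (suc m) (firstRowMinor 1 reduced)
      ≈⟨ +-cong (*-congˡ det-minor₀) (-‿cong (*-congˡ det-minor₁)) ⟩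
    V 0 * (V 0 * P m + V 1 * Q m) - x * (V 1 * P m + V 2 * Q m)
      ≈⟨ solve 6 (λ v₀ v₁ v₂ x p q → v₀ :* (v₀ :* p :+ v₁ :* q) :- x :* (v₁ :* p :+ v₂ :* q)
                                       := (v₀ :* v₀ :- x :* v₁) :* p :+ (v₀ :* v₁ :- x :* v₂) :* q)
           refl (V 0) (V 1) (V 2) x (P m) (Q m) ⟩
    toeplitzForm m ∎
    where
    minor₀ : ∀ i j → firstRowMinor 0 reduced i j ≈ bordered V i j
    minor₀ i zero    = reflexive (≡.cong V (absDiff-zeroʳ i))
    minor₀ i (suc k) = reduced-hessenberg i k
    minor₁ : ∀ i j → firstRowMinor 1 reduced i j ≈ bordered (V ∘ suc) i j
    minor₁ i zero    = reflexive (≡.cong V (absDiff-zeroʳ (suc i)))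
    minor₁ i (suc k) = reduced-hessenberg i k
    det-minor₀ : leadingDet (suc m) (firstRowMinor 0 reduced) ≈ V 0 * P m + V 1 * Q m
    det-minor₀ = trans (leadingDet-cong (suc m) minor₀) (leadingDet-bordered m V V-recurrence)
    det-minor₁ : leadingDet (suc m) (firstRowMinor 1 reduced) ≈ V 1 * P m + V 2 * Q m
    det-minor₁ = trans (leadingDet-cong (suc m) minor₁) (leadingDet-bordered m (V ∘ suc) (V-recurrence ∘ suc))

  toeplitzForm-recurrence : LinearRecurrence (t 0 + - (s * x)) (t 0 * - (s * x) - (t 1 + s * y) * - s) toeplitzForm
  toeplitzForm-recurrence = cayleyHamilton α β (λ _ → refl) (λ _ → refl)

-- Only x * x enters, so both x = 2B and x = −2B are covered.
module Specialisation {c ℓ : Level} (R : CommutativeRing c ℓ) (B x : CommutativeRing.Carrier R) where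
  open CommutativeRing R hiding (zero)
  open Determinant R
  open Recurrence R
  open LucasToeplitz R x B
  open IntegerSolver R using (Polynomial; solve; _:=_; _:+_; _:*_; :-_; _:-_; con)
  open import Relation.Binary.Reasoning.Setoid setoid

  U : ℕ → Carrier
  U = lucasU R (1# + B) (B * B)

  closedForm : ℕ → Carrier
  closedForm m = pow R (two R) (suc m) * (pow R (1# - B) m * U (suc m))

  τ δ : Carrier
  τ = two R * ((1# - B) * (1# + B))
  δ = two R * two R * ((1# - B) * (1# - B) * (B * B))

  -- Copies of the definitions in the solver's syntax, so that solver goals unfold to them definitionally.
  module ClosedFormSyntax {n : ℕ} (B : Polynomial n) where
    one two′ τᵖ δᵖ : Polynomial n
    one  = con (+ 1)
    two′ = con (+ 2)
    τᵖ   = two′ :* ((one :- B) :* (one :+ B))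
    δᵖ   = two′ :* two′ :* ((one :- B) :* (one :- B) :* (B :* B))

    powᵖ : Polynomial n → ℕ → Polynomial n
    powᵖ a zero    = one
    powᵖ a (suc k) = a :* powᵖ a k

    Uᵖ : ℕ → Polynomial n
    Uᵖ zero          = con (+ 0)
    Uᵖ (suc zero)    = one
    Uᵖ (suc (suc k)) = (one :+ B) :* Uᵖ (suc k) :- B :* B :* Uᵖ k

    closedFormᵖ : ℕ → Polynomial n
    closedFormᵖ m = powᵖ two′ (suc m) :* (powᵖ (one :- B) m :* Uᵖ (suc m))

  module ToeplitzSyntax {n : ℕ} (x B : Polynomial n) where
    open ClosedFormSyntax B public

    Vᵖ : ℕ → Polynomial n
    Vᵖ zero          = two′
    Vᵖ (suc zero)    = x
    Vᵖ (suc (suc k)) = x :* Vᵖ (suc k) :- B :* Vᵖ k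

    sᵖ : Polynomial n
    sᵖ = Vᵖ 1 :- x :* Vᵖ 0 :+ B :* Vᵖ 1

    tᵖ : ℕ → Polynomial n
    tᵖ i = Vᵖ i :- x :* Vᵖ (suc i) :+ B :* Vᵖ (suc (suc i))

    Pᵖ Qᵖ : ℕ → Polynomial n
    Pᵖ zero    = one
    Pᵖ (suc m) = tᵖ 0 :* Pᵖ m :+ (tᵖ 1 :+ sᵖ :* B) :* Qᵖ m
    Qᵖ zero    = con (+ 0)
    Qᵖ (suc m) = :- sᵖ :* Pᵖ m :+ :- (sᵖ :* x) :* Qᵖ m

    toeplitzFormᵖ : ℕ → Polynomial n
    toeplitzFormᵖ m = (Vᵖ 0 :* Vᵖ 0 :- x :* Vᵖ 1) :* Pᵖ m :+ (Vᵖ 0 :* Vᵖ 1 :- x :* Vᵖ 2) :* Qᵖ m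

  closedForm-recurrence : LinearRecurrence τ δ closedForm
  closedForm-recurrence m = solve 5 (λ B p q u₁ u₂ → let open ClosedFormSyntax B in
      two′ :* (two′ :* p) :* ((one :- B) :* ((one :- B) :* q) :* ((one :+ B) :* u₂ :- B :* B :* u₁))
        := τᵖ :* (two′ :* p :* ((one :- B) :* q :* u₂)) :- δᵖ :* (p :* (q :* u₁)))
    refl B (pow R (two R) (suc m)) (pow R (1# - B) m) (U (suc m)) (U (suc (suc m)))

  trace≈τ : t 0 + - (s * x) ≈ τ
  trace≈τ = solve 2 (λ x B → let open ToeplitzSyntax x B in tᵖ 0 :+ :- (sᵖ :* x) := τᵖ) refl x B

  module _ (x²≈[2B]² : x * x ≈ two R * B * (two R * B)) where

    determinant≈δ : t 0 * - (s * x) - (t 1 + s * B) * - s ≈ δ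
    determinant≈δ = begin
      t 0 * - (s * x) - (t 1 + s * B) * - s
        ≈⟨ solve 2 (λ x B → let open ToeplitzSyntax x B in
             tᵖ 0 :* :- (sᵖ :* x) :- (tᵖ 1 :+ sᵖ :* B) :* :- sᵖ := x :* x :* ((one :- B) :* (one :- B))) refl x B ⟩
      x * x * ((1# - B) * (1# - B))
        ≈⟨ *-congʳ x²≈[2B]² ⟩
      two R * B * (two R * B) * ((1# - B) * (1# - B))
        ≈⟨ solve 1 (λ B → let open ClosedFormSyntax B in
             two′ :* B :* (two′ :* B) :* ((one :- B) :* (one :- B)) := δᵖ) refl B ⟩
      δ ∎

    toeplitzForm₀≈closedForm₁ : toeplitzForm 0 ≈ closedForm 1
    toeplitzForm₀≈closedForm₁ = begin
      toeplitzForm 0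
        ≈⟨ solve 2 (λ x B → let open ToeplitzSyntax x B in toeplitzFormᵖ 0 := two′ :* two′ :- x :* x) refl x B ⟩
      two R * two R - x * x
        ≈⟨ +-congˡ (-‿cong x²≈[2B]²) ⟩
      two R * two R - two R * B * (two R * B)
        ≈⟨ solve 1 (λ B → let open ClosedFormSyntax B in two′ :* two′ :- two′ :* B :* (two′ :* B) := closedFormᵖ 1) refl B ⟩
      closedForm 1 ∎

    toeplitzForm₁≈closedForm₂ : toeplitzForm 1 ≈ closedForm 2
    toeplitzForm₁≈closedForm₂ = begin
      toeplitzForm 1
        ≈⟨ solve 2 (λ x B → let open ToeplitzSyntax x B in
             toeplitzFormᵖ 1 := two′ :* two′ :* (one :- B) :* (two′ :* (one :+ B) :- x :* x)) refl x B ⟩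
      two R * two R * (1# - B) * (two R * (1# + B) - x * x)
        ≈⟨ *-congˡ (+-congˡ (-‿cong x²≈[2B]²)) ⟩
      two R * two R * (1# - B) * (two R * (1# + B) - two R * B * (two R * B))
        ≈⟨ solve 1 (λ B → let open ClosedFormSyntax B in
             two′ :* two′ :* (one :- B) :* (two′ :* (one :+ B) :- two′ :* B :* (two′ :* B)) := closedFormᵖ 2) refl B ⟩
      closedForm 2 ∎

    leadingDet-toeplitz≈closedForm : ∀ m → leadingDet (suc m) toeplitz ≈ closedForm m
    leadingDet-toeplitz≈closedForm zero    = solve 1 (λ B → let open ClosedFormSyntax B in
      one :* (two′ :* one) :+ con (+ 0) := closedFormᵖ 0) refl B
    leadingDet-toeplitz≈closedForm (suc m) = trans (leadingDet-toeplitz m)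
      (linearRecurrence-unique toeplitzForm-τδ-recurrence (closedForm-recurrence ∘ suc)
                               toeplitzForm₀≈closedForm₁ toeplitzForm₁≈closedForm₂ m)
      where
      toeplitzForm-τδ-recurrence : LinearRecurrence τ δ toeplitzForm
      toeplitzForm-τδ-recurrence = linearRecurrence-cong trace≈τ determinant≈δ toeplitzForm-recurrence

corollary1p5 : {c ℓ : Level} (R : CommutativeRing c ℓ) →
    let open CommutativeRing R in
    (B : Carrier) (m : ℕ) →
      let n = suc m in
      (det R n (λ (j k : Fin n) → lucasV R (two R * B) B (absDiff (toℕ j) (toℕ k)))
        ≈ pow R (two R) n * (pow R (1# - B) m * lucasU R (1# + B) (B * B) n))
      × (det R n (λ (j k : Fin n) → lucasV R (- (two R * B)) B (absDiff (toℕ j) (toℕ k)))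
        ≈ pow R (two R) n * (pow R (1# - B) m * lucasU R (1# + B) (B * B) n))
corollary1p5 R B m =
  Specialisation.leadingDet-toeplitz≈closedForm R B (two R * B) refl m ,
  Specialisation.leadingDet-toeplitz≈closedForm R B (- (two R * B)) (-‿square (two R * B)) m
  where
  open CommutativeRing R
  open RingProperties ring using (-‿distribˡ-*; -‿distribʳ-*; -‿involutive)
  -‿square : ∀ u → - u * - u ≈ u * u
  -‿square u = trans (sym (-‿distribˡ-* u (- u))) (trans (-‿cong (sym (-‿distribʳ-* u u))) (-‿involutive _))
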